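{- Let $k\ge 2$, let $U$ be a set of size $n\ge k$, and let $\mathcal F$ be a family of $k$-element subsets of $U$ such that $|E_1\cap E_2|\le k-2$ for all distinct $E_1,E_2\in\mathcal F$. Let $V:=U\times\{0,1\}$ and let $\chi_{\mathcal F}\colon V^k\to C$ be the coloring in which two tuples $((u_1,a_1),\dots,(u_k,a_k))$ and $((u_1',a_1'),\dots,(u_k',a_k'))$ receive the same color if and only if (A) $u_i=u_i'$ for all $i\in[k]$, (B) $(u_i,a_i)=(u_j,a_j)\iff(u_i',a_i')=(u_j',a_j')$ for all $i,j\in[k]$, and (C) if $\{u_1,\dots,u_k\}\in\mathcal F$, then $\sum_{i\in[k]}a_i\equiv\sum_{i\in[k]}a_i'\pmod 2$. Then $\chi_{\mathcal F}$ is $k$-stable.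
   Context: The $k$-WL refinement of a coloring $\chi$ of $V^k$ is $\chi'(\vec v)=\big(\chi(\vec v),\{\!\{(\chi(\vec v[w/1]),\dots,\chi(\vec v[w/k]))\mid w\in V\}\!\}\big)$, where $\vec v[w/i]$ replaces the $i$-th entry by $w$. $\chi$ is $k$-stable if $\chi'$ and $\chi$ induce the same partition of $V^k$ into color classes. -}

module Defs where

open import Data.Nat using (ℕ; _%_)
open import Data.Bool using (Bool; true; false; if_then_else_)
open import Data.Fin using (Fin; _≟_)
open import Data.Fin.Subset using (Subset)
open import Data.Fin.Properties using (any?)
open import Data.Product using (_×_; Σ; proj₁; proj₂)
open import Data.List using (List; map; allFin)
open import Data.Nat.ListAction using (sum)
open import Data.List.Membership.Propositional using (_∈_)
open import Data.Vec using (tabulate)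
open import Relation.Nullary.Decidable using (does)
open import Relation.Binary.PropositionalEquality using (_≡_)
open import Function.Bundles using (_↔_; _⇔_; Inverse)

-- Vertex set V := U × {0,1} with U = Fin n (the bit 1 is `true`).
V : ℕ → Set
V n = Fin n × Bool

Tuple : ℕ → ℕ → Set
Tuple k n = Fin k → V n

_[_/_] : ∀ {k n} → Tuple k n → V n → Fin k → Tuple k n
(v [ w / i ]) j = if does (j ≟ i) then w else v j

-- A coloring of V^k, given by its "same color" relation (its kernel).
Coloring : ℕ → ℕ → Set₁
Coloring k n = Tuple k n → Tuple k n → Set

-- "χ'(v) = χ'(v')" for the k-WL refinement χ' of χ:
-- χ(v) = χ(v') and the multisets {{(χ(v[w/1]),…,χ(v[w/k])) | w ∈ V}} agree,
-- i.e. there is a bijection π of V matching them colour-tuple by colour-tuple.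
RefinedSame : ∀ {k n} → Coloring k n → Coloring k n
RefinedSame {k} {n} χ v v' =
  χ v v' × Σ (V n ↔ V n) (λ π → ∀ (w : V n) (i : Fin k) →
     χ (v [ w / i ]) (v' [ Inverse.to π w / i ]))

kStable : ∀ {k n} → Coloring k n → Set
kStable {k} {n} χ = ∀ (v v' : Tuple k n) → (χ v v' ⇔ RefinedSame χ v v')

support : ∀ {k n} → Tuple k n → Subset n
support {k} t = tabulate (λ x → does (any? (λ (i : Fin k) → proj₁ (t i) ≟ x)))

bitSum : ∀ {k n} → Tuple k n → ℕ
bitSum {k} t = sum (map (λ i → if proj₂ (t i) then 1 else 0) (allFin k))

χF : ∀ {k n} → List (Subset n) → Coloring k n
χF {k} F t t' =
  (∀ (i : Fin k) → proj₁ (t i) ≡ proj₁ (t' i)) ×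
  (∀ (i j : Fin k) → (t i ≡ t j) ⇔ (t' i ≡ t' j)) ×
  (support t ∈ F → bitSum t % 2 ≡ bitSum t' % 2)

-- Write v = (u, a) and v' = (u, a') with d = a + a'.  The bijection of V matching the
-- refined colours of v and v' is a fibrewise flip π(x, b) = (x, b + c x): any such flip
-- preserves conditions (A) and (B), and π ∘ v = v' forces c (u i) = d i, which is well
-- defined by (B).  Condition (C) for v[w/i], with w = (x, b), asks that c sums to 0 along
-- u[x/i] whenever its support is in F.  If x occurs in u, such a tuple is injective, so
-- u[x/i] = u and this is (C) for v.  Otherwise it dictates c x = Σ d + d i, and this does not
-- depend on i: two such indices with u i ≠ u i' would give two members of F meeting in k - 1
-- points.

module Submission where

open import Defs
open import Data.Nat using (ℕ; _≤_; _∸_)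
open import Data.Fin.Subset using (Subset; ∣_∣; _∩_)
open import Data.List using (List)
open import Data.List.Membership.Propositional using (_∈_)
open import Relation.Binary.PropositionalEquality using (_≡_; _≢_)

open import Data.Nat using (zero; suc; _+_; _<_; _%_; z≤n; s≤s)
open import Data.Nat.Properties
  using (module ≤-Reasoning; ≤-refl; ≤-trans; ≤-reflexive; <-irrefl; <⇒≱;
         +-comm; +-suc; +-monoʳ-≤)
open import Data.Nat.DivMod using (%-distribˡ-+)
open import Data.Nat.ListAction using (sum)
open import Data.Bool as Bool using (Bool; true; false; not; _xor_; if_then_else_)
open import Data.Bool.Properties
  using (xor-assoc; xor-comm; xor-same; xor-identityʳ; xor-annihilates-not; ¬-not;
         xor-∧-commutativeRing)
open import Data.Fin as Fin using (Fin; _≟_; punchIn; punchOut)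
open import Data.Fin.Properties using (any?; punchIn-punchOut)
open import Data.Fin.Subset as Subset using (_∪_; _⊆_; ⁅_⁆; _∉_)
open import Data.Fin.Subset.Properties
  using (p⊆q⇒∣p∣≤∣q∣; ∣p∣≤∣x∷p∣; ∣⁅x⁆∣≡1; ∣⊥∣≡0; ⊆-antisym; x∈⁅x⁆; x∈p∪q⁺; x∈p∩q⁺)
open import Data.Product using (_×_; _,_; proj₁; proj₂; ∃)
open import Data.Sum using (inj₁; inj₂)
open import Data.Empty using (⊥-elim)
import Data.List as List
open import Data.List.Properties using (map-tabulate)
open import Data.Vec using (_∷_; []; tabulate)
open import Data.Vec.Properties using (lookup∘tabulate; lookup⇒[]=; []=⇒lookup; ≡-dec)
import Data.List.Membership.DecPropositional as DecMembership
open import Function using (_∘_; Injective)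
open import Function.Bundles using (_↔_; _⇔_; mk⇔; mk↔ₛ′; Equivalence)
open import Relation.Nullary using (yes; no; does)
open import Relation.Nullary.Decidable using (dec-true)
open import Relation.Binary.PropositionalEquality
  using (refl; sym; trans; cong; cong₂; subst; _≗_; module ≡-Reasoning)
open import Algebra.Bundles using (CommutativeRing)
open import Algebra.Properties.CommutativeSemigroup
  (CommutativeRing.+-commutativeSemigroup xor-∧-commutativeRing) using (interchange)

private
  variable
    k n : ℕ
    A B : Set

-- Same body as _[_/_] from Defs, so v [ w / i ] is definitionally v [ i ≔ w ].
_[_≔_] : (Fin k → A) → Fin k → A → Fin k → A
(f [ i ≔ y ]) j = if does (j ≟ i) then y else f j

[≔]-updates : (f : Fin k → A) (i : Fin k) (y : A) → (f [ i ≔ y ]) i ≡ y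
[≔]-updates f i y with i ≟ i
... | yes _ = refl
... | no i≢i = ⊥-elim (i≢i refl)

[≔]-minimal : (f : Fin k → A) {i j : Fin k} (y : A) → j ≢ i → (f [ i ≔ y ]) j ≡ f j
[≔]-minimal f {i} {j} y j≢i with j ≟ i
... | yes j≡i = ⊥-elim (j≢i j≡i)
... | no _ = refl

[≔]-id : (f : Fin k → A) {i : Fin k} {y : A} → f i ≡ y → f [ i ≔ y ] ≗ f
[≔]-id f {i} fi≡y j with j ≟ i
... | yes refl = sym fi≡y
... | no _ = refl

∘-[≔] : (g : A → B) (f : Fin k → A) (i : Fin k) (y : A) → g ∘ (f [ i ≔ y ]) ≗ (g ∘ f) [ i ≔ g y ]
∘-[≔] g f i y j with j ≟ i
... | yes _ = refl
... | no _ = refl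

-- support t is definitionally image (proj₁ ∘ t).
image : (Fin k → Fin n) → Subset n
image {k} f = tabulate (λ x → does (any? (λ (i : Fin k) → f i ≟ x)))

∈-image : (f : Fin k → Fin n) (i : Fin k) → f i Subset.∈ image f
∈-image f i = lookup⇒[]= (f i) (image f)
  (trans (lookup∘tabulate _ (f i)) (dec-true (any? (λ j → f j ≟ f i)) (i , refl)))

∈-image⁻ : (f : Fin k → Fin n) {x : Fin n} → x Subset.∈ image f → ∃ λ i → f i ≡ x
∈-image⁻ f {x} x∈
  with any? (λ i → f i ≟ x) | trans (sym (lookup∘tabulate _ x)) ([]=⇒lookup x∈)
... | yes fi≡x | _ = fi≡x
... | no _ | ()

image-⊆ : (f : Fin k → Fin n) {p : Subset n} → (∀ i → f i Subset.∈ p) → image f ⊆ p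
image-⊆ f f∈p x∈ with ∈-image⁻ f x∈
... | i , refl = f∈p i

image-cong : {f g : Fin k → Fin n} → f ≗ g → image f ≡ image g
image-cong {f = f} {g} f≗g = ⊆-antisym
  (image-⊆ f λ i → subst (Subset._∈ image g) (sym (f≗g i)) (∈-image g i))
  (image-⊆ g λ i → subst (Subset._∈ image f) (f≗g i) (∈-image f i))

∣p∪q∣≤∣p∣+∣q∣ : (p q : Subset n) → ∣ p ∪ q ∣ ≤ ∣ p ∣ + ∣ q ∣
∣p∪q∣≤∣p∣+∣q∣ [] [] = z≤n
∣p∪q∣≤∣p∣+∣q∣ (true ∷ p) (b ∷ q) =
  s≤s (≤-trans (∣p∪q∣≤∣p∣+∣q∣ p q) (+-monoʳ-≤ ∣ p ∣ (∣p∣≤∣x∷p∣ b q)))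
∣p∪q∣≤∣p∣+∣q∣ (false ∷ p) (true ∷ q) =
  ≤-trans (s≤s (∣p∪q∣≤∣p∣+∣q∣ p q)) (≤-reflexive (sym (+-suc ∣ p ∣ ∣ q ∣)))
∣p∪q∣≤∣p∣+∣q∣ (false ∷ p) (false ∷ q) = ∣p∪q∣≤∣p∣+∣q∣ p q

∣p∪⁅x⁆∣≤1+∣p∣ : (p : Subset n) (x : Fin n) → ∣ p ∪ ⁅ x ⁆ ∣ ≤ suc ∣ p ∣
∣p∪⁅x⁆∣≤1+∣p∣ p x = ≤-trans (∣p∪q∣≤∣p∣+∣q∣ p ⁅ x ⁆)
  (≤-reflexive (trans (cong (∣ p ∣ +_) (∣⁅x⁆∣≡1 x)) (+-comm ∣ p ∣ 1)))

∣image∣≤ : (f : Fin k → Fin n) → ∣ image f ∣ ≤ k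
∣image∣≤ {zero} {n} f = ≤-trans (p⊆q⇒∣p∣≤∣q∣ (image-⊆ f {Subset.⊥} λ ())) (≤-reflexive (∣⊥∣≡0 n))
∣image∣≤ {suc k} f =
  ≤-trans (p⊆q⇒∣p∣≤∣q∣ (image-⊆ f {image (f ∘ Fin.suc) ∪ ⁅ f Fin.zero ⁆} image-∪))
  (≤-trans (∣p∪⁅x⁆∣≤1+∣p∣ (image (f ∘ Fin.suc)) (f Fin.zero)) (s≤s (∣image∣≤ (f ∘ Fin.suc))))
  where
  image-∪ : ∀ i → f i Subset.∈ image (f ∘ Fin.suc) ∪ ⁅ f Fin.zero ⁆
  image-∪ Fin.zero = x∈p∪q⁺ (inj₂ (x∈⁅x⁆ (f Fin.zero)))
  image-∪ (Fin.suc i) = x∈p∪q⁺ (inj₁ (∈-image (f ∘ Fin.suc) i))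

∣image∣< : (f : Fin k → Fin n) {i j : Fin k} → i ≢ j → f i ≡ f j → ∣ image f ∣ < k
∣image∣< {suc k} f {i} {j} i≢j fi≡fj =
  s≤s (≤-trans (p⊆q⇒∣p∣≤∣q∣ (image-⊆ f {image (f ∘ punchIn i)} image-punchIn))
               (∣image∣≤ (f ∘ punchIn i)))
  where
  image-punchIn : ∀ m → f m Subset.∈ image (f ∘ punchIn i)
  image-punchIn m with m ≟ i
  ... | yes refl = subst (Subset._∈ image (f ∘ punchIn i))
                     (trans (cong f (punchIn-punchOut i≢j)) (sym fi≡fj))
                     (∈-image _ (punchOut i≢j))
  ... | no m≢i = subst (Subset._∈ image (f ∘ punchIn i))
                   (cong f (punchIn-punchOut (m≢i ∘ sym))) (∈-image _ (punchOut (m≢i ∘ sym)))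

[≔]-∈-image : (f : Fin k → Fin n) {i j m : Fin k} (x : Fin n) → m ≢ j →
              (f [ i ≔ x ]) m Subset.∈ image (f [ j ≔ x ])
[≔]-∈-image f {i} {j} {m} x m≢j with m ≟ i
... | yes _ = subst (Subset._∈ image (f [ j ≔ x ])) ([≔]-updates f j x) (∈-image _ j)
... | no _ = subst (Subset._∈ image (f [ j ≔ x ])) ([≔]-minimal f x m≢j) (∈-image _ m)

parity : (Fin k → Bool) → Bool
parity {zero} _ = false
parity {suc k} f = f Fin.zero xor parity (f ∘ Fin.suc)

parity-cong : {f g : Fin k → Bool} → f ≗ g → parity f ≡ parity g
parity-cong {zero} _ = refl
parity-cong {suc k} f≗g = cong₂ _xor_ (f≗g Fin.zero) (parity-cong (f≗g ∘ Fin.suc))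

parity-xor : (f g : Fin k → Bool) → parity (λ j → f j xor g j) ≡ parity f xor parity g
parity-xor {zero} f g = refl
parity-xor {suc k} f g = trans
  (cong ((f Fin.zero xor g Fin.zero) xor_) (parity-xor (f ∘ Fin.suc) (g ∘ Fin.suc)))
  (interchange (f Fin.zero) (g Fin.zero) (parity (f ∘ Fin.suc)) (parity (g ∘ Fin.suc)))

parity-[≔] : (f : Fin k → Bool) (i : Fin k) (y : Bool) →
             parity (f [ i ≔ y ]) ≡ parity f xor (f i xor y)
parity-[≔] {suc k} f Fin.zero y = begin
  y xor p                     ≡⟨ xor-comm y p ⟩
  p xor y                     ≡⟨ cong (_xor (p xor y)) (xor-same f₀) ⟨
  (f₀ xor f₀) xor (p xor y)   ≡⟨ interchange f₀ f₀ p y ⟩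
  (f₀ xor p) xor (f₀ xor y)   ∎
  where
  open ≡-Reasoning
  f₀ p : Bool
  f₀ = f Fin.zero
  p = parity (f ∘ Fin.suc)
parity-[≔] {suc k} f (Fin.suc i) y = trans
  (cong (f Fin.zero xor_) (parity-[≔] (f ∘ Fin.suc) i y))
  (sym (xor-assoc (f Fin.zero) (parity (f ∘ Fin.suc)) (f (Fin.suc i) xor y)))

bit : Bool → ℕ
bit b = if b then 1 else 0

bit-injective : {x y : Bool} → bit x ≡ bit y → x ≡ y
bit-injective {false} {false} _ = refl
bit-injective {true} {true} _ = refl

bit+%2 : (b : Bool) {s : ℕ} {c : Bool} → s % 2 ≡ bit c → (bit b + s) % 2 ≡ bit (b xor c)
bit+%2 false s%2≡c = s%2≡c
bit+%2 true {s} {c} s%2≡c =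
  trans (%-distribˡ-+ 1 s 2) (trans (cong (λ r → (1 + r) % 2) s%2≡c) (suc-bit%2 c))
  where
  suc-bit%2 : ∀ c → suc (bit c) % 2 ≡ bit (not c)
  suc-bit%2 false = refl
  suc-bit%2 true = refl

sum-bits%2 : (f : Fin k → Bool) → sum (List.tabulate (bit ∘ f)) % 2 ≡ bit (parity f)
sum-bits%2 {zero} f = refl
sum-bits%2 {suc k} f = bit+%2 (f Fin.zero) (sum-bits%2 (f ∘ Fin.suc))

bitSum%2 : (t : Tuple k n) → bitSum t % 2 ≡ bit (parity (proj₂ ∘ t))
bitSum%2 t = trans (cong (λ bits → sum bits % 2) (map-tabulate (λ i → i) (bit ∘ proj₂ ∘ t)))
                   (sum-bits%2 (proj₂ ∘ t))

bitSum%2-⇔ : (t t' : Tuple k n) →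
             (bitSum t % 2 ≡ bitSum t' % 2) ⇔ (parity (proj₂ ∘ t) ≡ parity (proj₂ ∘ t'))
bitSum%2-⇔ t t' = mk⇔
  (λ eq → bit-injective (trans (sym (bitSum%2 t)) (trans eq (bitSum%2 t'))))
  (λ eq → trans (bitSum%2 t) (trans (cong bit eq) (sym (bitSum%2 t'))))

xor-cong-⇔ : {x y x' y' : Bool} → (x ≡ y ⇔ x' ≡ y') → x xor x' ≡ y xor y'
xor-cong-⇔ {x} {y} {x'} {y'} x≡y⇔x'≡y' with x Bool.≟ y
... | yes refl = cong (x xor_) (Equivalence.to x≡y⇔x'≡y' refl)
... | no x≢y = begin
  x xor x'           ≡⟨ xor-annihilates-not x x' ⟨
  not x xor not x'   ≡⟨ cong₂ _xor_ (¬-not (x≢y ∘ sym)) (¬-not (x'≢y' ∘ sym)) ⟨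
  y xor y'           ∎
  where
  open ≡-Reasoning
  x'≢y' : x' ≢ y'
  x'≢y' = x≢y ∘ Equivalence.from x≡y⇔x'≡y'

flip : (Fin n → Bool) → V n → V n
flip c (x , b) = x , b xor c x

flip-involutive : (c : Fin n → Bool) (w : V n) → flip c (flip c w) ≡ w
flip-involutive c (x , b) = cong (x ,_) (begin
  (b xor c x) xor c x   ≡⟨ xor-assoc b (c x) (c x) ⟩
  b xor (c x xor c x)   ≡⟨ cong (b xor_) (xor-same (c x)) ⟩
  b xor false           ≡⟨ xor-identityʳ b ⟩
  b                     ∎)
  where open ≡-Reasoning

flip-injective : (c : Fin n → Bool) → Injective _≡_ _≡_ (flip c)
flip-injective c {w} {w'} eq =
  trans (sym (flip-involutive c w)) (trans (cong (flip c) eq) (flip-involutive c w'))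

flip-↔ : (Fin n → Bool) → V n ↔ V n
flip-↔ c = mk↔ₛ′ (flip c) (flip c) (flip-involutive c) (flip-involutive c)

χF-flip : (F : List (Subset n)) (c : Fin n → Bool) {t t' : Tuple k n} → flip c ∘ t ≗ t' →
          (support t ∈ F → parity (c ∘ proj₁ ∘ t) ≡ false) → χF F t t'
χF-flip F c {t} {t'} flip-t≗t' balanced = same-points , same-equalities , same-parity
  where
  same-points : ∀ i → proj₁ (t i) ≡ proj₁ (t' i)
  same-points i = cong proj₁ (flip-t≗t' i)

  same-equalities : ∀ i j → (t i ≡ t j) ⇔ (t' i ≡ t' j)
  same-equalities i j = mk⇔
    (λ eq → trans (sym (flip-t≗t' i)) (trans (cong (flip c) eq) (flip-t≗t' j)))
    (λ eq → flip-injective c (trans (flip-t≗t' i) (trans eq (sym (flip-t≗t' j)))))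

  same-parity : support t ∈ F → bitSum t % 2 ≡ bitSum t' % 2
  same-parity t∈F = Equivalence.from (bitSum%2-⇔ t t') (begin
    p                                   ≡⟨ xor-identityʳ p ⟨
    p xor false                         ≡⟨ cong (p xor_) (balanced t∈F) ⟨
    p xor parity (c ∘ proj₁ ∘ t)        ≡⟨ parity-xor (proj₂ ∘ t) (c ∘ proj₁ ∘ t) ⟨
    parity (proj₂ ∘ flip c ∘ t)         ≡⟨ parity-cong (cong proj₂ ∘ flip-t≗t') ⟩
    parity (proj₂ ∘ t')                 ∎)
    where
    open ≡-Reasoning
    p : Bool
    p = parity (proj₂ ∘ t)

suc[k∸2]<k : 2 ≤ k → suc (k ∸ 2) < k
suc[k∸2]<k (s≤s (s≤s _)) = ≤-refl

module UniformFamily (F : List (Subset n)) (uniform : ∀ E → E ∈ F → ∣ E ∣ ≡ k) where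

  image∈F⇒injective : (f : Fin k → Fin n) → image f ∈ F → Injective _≡_ _≡_ f
  image∈F⇒injective f f∈F {i} {j} fi≡fj with i ≟ j
  ... | yes i≡j = i≡j
  ... | no i≢j = ⊥-elim (<-irrefl (uniform _ f∈F) (∣image∣< f i≢j fi≡fj))

  [≔]-collision : (f : Fin k → Fin n) {m i : Fin k} {x : Fin n} →
                  f m ≡ x → image (f [ i ≔ x ]) ∈ F → m ≡ i
  [≔]-collision f {m} {i} {x} fm≡x f[i≔x]∈F with m ≟ i
  ... | yes m≡i = m≡i
  ... | no m≢i = image∈F⇒injective _ f[i≔x]∈F
        (trans ([≔]-minimal f x m≢i) (trans fm≡x (sym ([≔]-updates f i x))))

  module _ (2≤k : 2 ≤ k)
    (sparse : ∀ E₁ E₂ → E₁ ∈ F → E₂ ∈ F → E₁ ≢ E₂ → ∣ E₁ ∩ E₂ ∣ ≤ k ∸ 2) where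

    [≔]∈F-unique : (f : Fin k → Fin n) {x : Fin n} {i j : Fin k} → (∀ m → f m ≢ x) →
                   image (f [ i ≔ x ]) ∈ F → image (f [ j ≔ x ]) ∈ F → f i ≡ f j
    [≔]∈F-unique f {x} {i} {j} x∉f S∈F S'∈F with f i ≟ f j
    ... | yes fi≡fj = fi≡fj
    ... | no fi≢fj = ⊥-elim (<⇒≱ (suc[k∸2]<k 2≤k) (begin
      k                        ≡⟨ uniform S S∈F ⟨
      ∣ S ∣                    ≤⟨ p⊆q⇒∣p∣≤∣q∣ {p = S} {q = (S ∩ S') ∪ ⁅ f j ⁆} S⊆S∩S'∪fj ⟩
      ∣ (S ∩ S') ∪ ⁅ f j ⁆ ∣   ≤⟨ ∣p∪⁅x⁆∣≤1+∣p∣ (S ∩ S') (f j) ⟩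
      suc ∣ S ∩ S' ∣           ≤⟨ s≤s (sparse S S' S∈F S'∈F S≢S') ⟩
      suc (k ∸ 2)              ∎))
      where
      open ≤-Reasoning
      S S' : Subset n
      S = image (f [ i ≔ x ])
      S' = image (f [ j ≔ x ])

      i≢j : i ≢ j
      i≢j i≡j = fi≢fj (cong f i≡j)

      S⊆S∩S'∪fj : S ⊆ (S ∩ S') ∪ ⁅ f j ⁆
      S⊆S∩S'∪fj = image-⊆ (f [ i ≔ x ]) {(S ∩ S') ∪ ⁅ f j ⁆} f[i≔x]-∈
        where
        f[i≔x]-∈ : ∀ m → (f [ i ≔ x ]) m Subset.∈ (S ∩ S') ∪ ⁅ f j ⁆
        f[i≔x]-∈ m with m ≟ j
        ... | yes refl = x∈p∪q⁺ (inj₂ (subst (Subset._∈ ⁅ f m ⁆)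
                           (sym ([≔]-minimal f x (i≢j ∘ sym))) (x∈⁅x⁆ (f m))))
        ... | no m≢j = x∈p∪q⁺ (inj₁ (x∈p∩q⁺ (∈-image _ m , [≔]-∈-image f x m≢j)))

      fi∉S : f i ∉ S
      fi∉S fi∈S with ∈-image⁻ (f [ i ≔ x ]) fi∈S
      ... | m , f[i≔x]m≡fi with m ≟ i
      ...   | yes refl = x∉f m (sym f[i≔x]m≡fi)
      ...   | no m≢i with m ≟ j
      ...     | yes refl = fi≢fj (sym f[i≔x]m≡fi)
      ...     | no m≢j = m≢i (image∈F⇒injective _ S'∈F
                  (trans ([≔]-minimal f x m≢j) (trans f[i≔x]m≡fi (sym ([≔]-minimal f x i≢j)))))

      S≢S' : S ≢ S'
      S≢S' S≡S' = fi∉S (subst (f i Subset.∈_) (sym S≡S')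
        (subst (Subset._∈ S') ([≔]-minimal f x i≢j) (∈-image _ i)))

module Refinement (F : List (Subset n)) (uniform : ∀ E → E ∈ F → ∣ E ∣ ≡ k) (2≤k : 2 ≤ k)
  (sparse : ∀ E₁ E₂ → E₁ ∈ F → E₂ ∈ F → E₁ ≢ E₂ → ∣ E₁ ∩ E₂ ∣ ≤ k ∸ 2)
  {v v' : Tuple k n} (χvv' : χF F v v') where

  open UniformFamily F uniform
  open DecMembership (≡-dec {n = n} Bool._≟_) using (_∈?_)

  u : Fin k → Fin n
  u = proj₁ ∘ v

  d : Fin k → Bool
  d j = proj₂ (v j) xor proj₂ (v' j)

  d-respects-u : ∀ {i j} → u i ≡ u j → d i ≡ d j
  d-respects-u {i} {j} ui≡uj = xor-cong-⇔ (mk⇔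
    (λ ai≡aj → cong proj₂ (Equivalence.to (same-equalities i j) (cong₂ _,_ ui≡uj ai≡aj)))
    (λ a'i≡a'j → cong proj₂ (Equivalence.from (same-equalities i j) (cong₂ _,_ u'i≡u'j a'i≡a'j))))
    where
    same-equalities : ∀ i j → (v i ≡ v j) ⇔ (v' i ≡ v' j)
    same-equalities = proj₁ (proj₂ χvv')
    u'i≡u'j : proj₁ (v' i) ≡ proj₁ (v' j)
    u'i≡u'j = trans (sym (proj₁ χvv' i)) (trans ui≡uj (proj₁ χvv' j))

  parity-d : support v ∈ F → parity d ≡ false
  parity-d v∈F = begin
    parity d                         ≡⟨ parity-xor (proj₂ ∘ v) (proj₂ ∘ v') ⟩
    p xor parity (proj₂ ∘ v')        ≡⟨ cong (p xor_) same-parity ⟨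
    p xor p                          ≡⟨ xor-same p ⟩
    false                            ∎
    where
    open ≡-Reasoning
    p : Bool
    p = parity (proj₂ ∘ v)
    same-parity : p ≡ parity (proj₂ ∘ v')
    same-parity = Equivalence.to (bitSum%2-⇔ v v') (proj₂ (proj₂ χvv') v∈F)

  Consistent : Fin n → Bool → Set
  Consistent x b = (∀ {m} → u m ≡ x → d m ≡ b) ×
                   (∀ i → image (u [ i ≔ x ]) ∈ F → parity d xor d i ≡ b)

  consistent : ∀ x → ∃ (Consistent x)
  consistent x with any? (λ m → u m ≟ x)
  ... | yes (m , um≡x) = d m , (λ um'≡x → d-respects-u (trans um'≡x (sym um≡x))) , on-update
    where
    on-update : ∀ i → image (u [ i ≔ x ]) ∈ F → parity d xor d i ≡ d m
    on-update i u[i≔x]∈F with [≔]-collision u um≡x u[i≔x]∈F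
    ... | refl = cong (_xor d m)
                   (parity-d (subst (_∈ F) (image-cong ([≔]-id u um≡x)) u[i≔x]∈F))
  ... | no x∉u with any? (λ i → image (u [ i ≔ x ]) ∈? F)
  ...   | yes (i , u[i≔x]∈F) = parity d xor d i , (λ um≡x → ⊥-elim (x∉u (_ , um≡x))) ,
          λ j u[j≔x]∈F → cong (parity d xor_) (d-respects-u
            ([≔]∈F-unique 2≤k sparse u (λ m um≡x → x∉u (m , um≡x)) u[j≔x]∈F u[i≔x]∈F))
  ...   | no x∉F = false , (λ um≡x → ⊥-elim (x∉u (_ , um≡x))) ,
          λ i u[i≔x]∈F → ⊥-elim (x∉F (i , u[i≔x]∈F))

  c : Fin n → Bool
  c x = proj₁ (consistent x)

  c∘u≗d : c ∘ u ≗ d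
  c∘u≗d j = sym (proj₁ (proj₂ (consistent (u j))) refl)

  c-at-update : ∀ {i x} → image (u [ i ≔ x ]) ∈ F → parity d xor d i ≡ c x
  c-at-update {i} {x} = proj₂ (proj₂ (consistent x)) i

  flip-v : ∀ j → flip c (v j) ≡ v' j
  flip-v j = cong₂ _,_ (proj₁ χvv' j) (begin
    a j xor c (u j)          ≡⟨ cong (a j xor_) (c∘u≗d j) ⟩
    a j xor (a j xor a' j)   ≡⟨ xor-assoc (a j) (a j) (a' j) ⟨
    (a j xor a j) xor a' j   ≡⟨ cong (_xor a' j) (xor-same (a j)) ⟩
    a' j                     ∎)
    where
    open ≡-Reasoning
    a a' : Fin k → Bool
    a = proj₂ ∘ v
    a' = proj₂ ∘ v'

  flip-v[/] : ∀ w i → flip c ∘ (v [ w / i ]) ≗ v' [ flip c w / i ]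
  flip-v[/] w i j with j ≟ i
  ... | yes _ = refl
  ... | no _ = flip-v j

  balanced : ∀ w i → support (v [ w / i ]) ∈ F → parity (c ∘ proj₁ ∘ (v [ w / i ])) ≡ false
  balanced w@(x , _) i t∈F = begin
    parity (c ∘ proj₁ ∘ (v [ w / i ]))     ≡⟨ parity-cong (∘-[≔] (c ∘ proj₁) v i w) ⟩
    parity ((c ∘ u) [ i ≔ c x ])           ≡⟨ parity-[≔] (c ∘ u) i (c x) ⟩
    parity (c ∘ u) xor (c (u i) xor c x)   ≡⟨ cong₂ (λ p q → p xor (q xor c x))
                                                   (parity-cong c∘u≗d) (c∘u≗d i) ⟩
    parity d xor (d i xor c x)             ≡⟨ xor-assoc (parity d) (d i) (c x) ⟨
    (parity d xor d i) xor c x             ≡⟨ cong (_xor c x) (c-at-update u[i≔x]∈F) ⟩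
    c x xor c x                            ≡⟨ xor-same (c x) ⟩
    false                                  ∎
    where
    open ≡-Reasoning
    u[i≔x]∈F : image (u [ i ≔ x ]) ∈ F
    u[i≔x]∈F = subst (_∈ F) (image-cong (∘-[≔] proj₁ v i w)) t∈F

  refined : RefinedSame (χF F) v v'
  refined = χvv' , flip-↔ c , λ w i → χF-flip F c (flip-v[/] w i) (balanced w i)

lemma4p3 : (k n : ℕ) → 2 ≤ k → k ≤ n → (F : List (Subset n)) →
    (∀ E → E ∈ F → ∣ E ∣ ≡ k) →
    (∀ E₁ E₂ → E₁ ∈ F → E₂ ∈ F → E₁ ≢ E₂ → ∣ E₁ ∩ E₂ ∣ ≤ k ∸ 2) →
    kStable {k} {n} (χF F)
lemma4p3 k n 2≤k _ F uniform sparse v v' =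
  mk⇔ (Refinement.refined F uniform 2≤k sparse) proj₁
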